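{- Let $p$ be a prime, and let $r,\alpha,\gamma$ be positive integers with $\alpha>1$ and $p\nmid\gamma$. If $p^\alpha\gamma\in F_r$, then $p^{\alpha-1}\gamma\in F_r$.
   Context: For a positive integer $r$, $S_r$ is the multiplicative function with $S_r(p^\alpha)=0$ if $p\le r$ and $S_r(p^\alpha)=p^{\alpha-1}(p-r)$ if $p>r$ (for primes $p$, positive integers $\alpha$). $B_r=\{n\in\mathbb{N}: S_r(n)>0\}$, i.e. $1$ together with the positive integers whose smallest prime factor exceeds $r$. $F_r$ is the set of $n\in B_r$ such that $S_r(n)<S_r(m)$ for all $m\in B_r$ with $m>n$. -}

module Defs where

open import Data.Nat using (ℕ; zero; suc; _+_; _*_; _∸_; _^_; _≤_; _<_; _>_)
open import Data.Nat.Properties using (_≤?_)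
open import Data.Nat.DivMod using (_/_)
open import Data.Nat.Divisibility using (_∣_; _∣?_)
open import Data.Nat.Primality using (Prime; prime?)
open import Data.List using (List; upTo; map)
open import Data.Nat.ListAction using (product)
open import Data.Product using (_×_)
open import Relation.Nullary using (yes; no)

-- p-adic valuation v_p(n) (with fuel); for p ≤ 1 or n = 0 it returns 0 (unused).
valAux : ℕ → ℕ → ℕ → ℕ
valAux fuel       0 n = 0
valAux fuel       1 n = 0
valAux zero       (suc (suc k)) n = 0
valAux (suc fuel) (suc (suc k)) zero = 0
valAux (suc fuel) (suc (suc k)) (suc m) with suc (suc k) ∣? suc m
... | yes _ = suc (valAux fuel (suc (suc k)) (suc m / suc (suc k)))
... | no  _ = 0

val : ℕ → ℕ → ℕ
val p n = valAux n p n

Sloc : ℕ → ℕ → ℕ → ℕ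
Sloc r p zero = 1
Sloc r p (suc a) with p ≤? r
... | yes _ = 0
... | no  _ = p ^ a * (p ∸ r)

Sfac : ℕ → ℕ → ℕ → ℕ
Sfac r n p with prime? p
... | yes _ = Sloc r p (val p n)
... | no  _ = 1

-- S_r(n) for n ≥ 1: the multiplicative function with the given prime-power
-- values, i.e. the product over primes p ≤ n of S_r(p^(v_p(n))).
-- (upTo (suc n) = [0, 1, ..., n].)
S : ℕ → ℕ → ℕ
S r n = product (map (Sfac r n) (upTo (suc n)))

B : ℕ → ℕ → Set
B r n = (1 ≤ n) × (S r n > 0)

F : ℕ → ℕ → Set
F r n = B r n × (∀ m → B r m → m > n → S r n < S r m)

{-# OPTIONS --safe #-}
module Submission where

open import Defs
open import Data.Nat using (ℕ; _*_; _∸_; _^_; _≤_; _<_)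
open import Data.Nat.Divisibility using (_∣_)
open import Data.Nat.Primality using (Prime)
open import Relation.Nullary using (¬_)

open import Data.Nat using (zero; suc; _+_; _>_; z≤n; s≤s; s≤s⁻¹; _≟_; _≤?_; nonTrivial⇒n>1; >-nonZero)
open import Data.Nat.Properties
open import Data.Nat.DivMod using (_/_; m/n<m; m*n/n≡m)
open import Data.Nat.Divisibility using (_∣?_; divides; ∣⇒≤; m∣m*n; ∣m⇒∣m*n)
open import Data.Nat.Induction using (<-wellFounded)
open import Data.Nat.Primality using (prime?; euclidsLemma; prime⇒irreducible; prime⇒nonTrivial; prime⇒nonZero)
open import Data.Nat.ListAction using (product)
open import Data.Nat.ListAction.Properties using (product-++)
open import Data.List using (upTo; map; _∷_; []; _++_)
open import Data.List.Properties using (upTo-∷ʳ; map-++)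
open import Data.Product using (_×_; _,_; ∃-syntax)
open import Data.Sum using (inj₁; inj₂; [_,_]′)
open import Function using (_∘_)
open import Induction.WellFounded using (Acc; acc)
open import Relation.Nullary using (yes; no; contradiction)
open import Relation.Binary.PropositionalEquality
open ≡-Reasoning

-- Split S_r(n) as the p-part S_r(p^{v_p(n)}) times the product R
-- of the remaining prime-power factors; multiplying n by p changes only the
-- p-part.  Hence S_r(pm) = 0 if p ≤ r, while for p > r we have S_r(pk) ≤ p S_r(k)
-- for all k, with equality when p ∣ k.  So if pm ∈ F_r and p ∣ m, then for
-- every k ∈ B_r beyond m:  p S_r(m) = S_r(pm) < S_r(pk) ≤ p S_r(k).

*-pos : ∀ {m n} → 0 < m → 0 < n → 0 < m * n
*-pos {suc m} {suc n} _ _ = s≤s z≤n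

*-pos⁻¹ʳ : ∀ m {n} → 0 < m * n → 0 < n
*-pos⁻¹ʳ m {zero} 0<m*0 = contradiction (subst (0 <_) (*-zeroʳ m) 0<m*0) (λ ())
*-pos⁻¹ʳ m {suc n} _ = s≤s z≤n

prime⇒2≤ : ∀ {p} → Prime p → 2 ≤ p
prime⇒2≤ {p} p-prime = nonTrivial⇒n>1 p {{prime⇒nonTrivial p-prime}}

prime∤prime : ∀ {p q} → Prime q → Prime p → q ≢ p → ¬ q ∣ p
prime∤prime q-prime p-prime q≢p q∣p with prime⇒irreducible p-prime q∣p
... | inj₁ refl = contradiction (prime⇒2≤ q-prime) λ { (s≤s ()) }
... | inj₂ q≡p  = q≢p q≡p

valAux-fuel : ∀ {q f₁ f₂ n} → 2 ≤ q → n ≤ f₁ → n ≤ f₂ → valAux f₁ q n ≡ valAux f₂ q n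
valAux-fuel {f₁ = zero}  {zero}  {zero}  (s≤s (s≤s _)) _ _ = refl
valAux-fuel {f₁ = zero}  {suc _} {zero}  (s≤s (s≤s _)) _ _ = refl
valAux-fuel {f₁ = suc _} {zero}  {zero}  (s≤s (s≤s _)) _ _ = refl
valAux-fuel {f₁ = suc _} {suc _} {zero}  (s≤s (s≤s _)) _ _ = refl
valAux-fuel {suc (suc k)} {suc f₁} {suc f₂} {suc m} 2≤q@(s≤s (s≤s _)) m<f₁ m<f₂ with suc (suc k) ∣? suc m
... | yes _ = cong suc (valAux-fuel 2≤q (quotient≤ m<f₁) (quotient≤ m<f₂))
  where
  quotient≤ : ∀ {f} → suc m ≤ suc f → suc m / suc (suc k) ≤ f
  quotient≤ m<f = s≤s⁻¹ (≤-trans (m/n<m (suc m) (suc (suc k)) 2≤q) m<f)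
... | no  _ = refl

valAux-∣ : ∀ {k} f {m} → suc (suc k) ∣ suc m →
  valAux (suc f) (suc (suc k)) (suc m) ≡ suc (valAux f (suc (suc k)) (suc m / suc (suc k)))
valAux-∣ {k} f {m} q∣m with suc (suc k) ∣? suc m
... | yes _   = refl
... | no  q∤m = contradiction q∣m q∤m

val-∤ : ∀ {q n} → 2 ≤ q → ¬ q ∣ n → val q n ≡ 0
val-∤ {n = zero}  (s≤s (s≤s _)) _ = refl
val-∤ {suc (suc k)} {suc m} (s≤s (s≤s _)) q∤n with suc (suc k) ∣? suc m
... | yes q∣n = contradiction q∣n q∤n
... | no  _   = refl

val-q* : ∀ {q n} → 2 ≤ q → 1 ≤ n → val q (q * n) ≡ suc (val q n)
val-q* {q@(suc (suc k))} {n@(suc n-1)} 2≤q@(s≤s (s≤s _)) _ = begin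
  val q (q * n)              ≡⟨ valAux-∣ fuel (m∣m*n n) ⟩
  suc (valAux fuel q (q * n / q)) ≡⟨ cong (suc ∘ valAux fuel q) q*n/q≡n ⟩
  suc (valAux fuel q n)      ≡⟨ cong suc (valAux-fuel 2≤q n≤fuel ≤-refl) ⟩
  suc (val q n)              ∎
  where
  fuel = n-1 + suc k * n
  n≤fuel : n ≤ fuel
  n≤fuel = ≤-trans (m≤n*m n (suc k)) (m≤n+m (suc k * n) n-1)
  q*n/q≡n : q * n / q ≡ n
  q*n/q≡n = trans (cong (_/ q) (*-comm q n)) (m*n/n≡m n q)

val-∣ : ∀ {q m} → 2 ≤ q → q ∣ m → 1 ≤ m → 1 ≤ val q m
val-∣ {q} 2≤q (divides j refl) 1≤j*q = subst (1 ≤_) (sym (trans (cong (val q) (*-comm j q)) (val-q* 2≤q 1≤j))) (s≤s z≤n)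
  where
  1≤j : 1 ≤ j
  1≤j = *-pos⁻¹ʳ q (subst (0 <_) (*-comm j q) 1≤j*q)

val-*-∤ : ∀ {q a m} → Prime q → ¬ q ∣ a → 1 ≤ m → val q (a * m) ≡ val q m
val-*-∤ {q} {a} {m} q-prime q∤a = go m (<-wellFounded m)
  where
  2≤q = prime⇒2≤ q-prime
  1≤a : 1 ≤ a
  1≤a = n≢0⇒n>0 (λ { refl → q∤a (divides 0 refl) })

  go : ∀ m → Acc _<_ m → 1 ≤ m → val q (a * m) ≡ val q m
  go m (acc rec) 1≤m with q ∣? m
  ... | no q∤m = trans (val-∤ 2≤q q∤a*m) (sym (val-∤ 2≤q q∤m))
    where
    q∤a*m : ¬ q ∣ a * m
    q∤a*m q∣a*m = [ q∤a , q∤m ]′ (euclidsLemma a m q-prime q∣a*m)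
  ... | yes (divides j refl) = begin
    val q (a * (j * q)) ≡⟨ cong (val q) (trans (sym (*-assoc a j q)) (*-comm (a * j) q)) ⟩
    val q (q * (a * j)) ≡⟨ val-q* 2≤q (*-pos 1≤a 1≤j) ⟩
    suc (val q (a * j)) ≡⟨ cong suc (go j (rec (m<m*n j q {{>-nonZero 1≤j}} 2≤q)) 1≤j) ⟩
    suc (val q j)       ≡⟨ sym (val-q* 2≤q 1≤j) ⟩
    val q (q * j)       ≡⟨ cong (val q) (*-comm q j) ⟩
    val q (j * q)       ∎
    where
    1≤j : 1 ≤ j
    1≤j = n≢0⇒n>0 (λ { refl → contradiction 1≤m (λ ()) })

∏< : ℕ → (ℕ → ℕ) → ℕ
∏< zero    f = 1
∏< (suc N) f = ∏< N f * f N

product-map-upTo : ∀ f N → product (map f (upTo N)) ≡ ∏< N f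
product-map-upTo f zero    = refl
product-map-upTo f (suc N) = begin
  product (map f (upTo (suc N)))           ≡⟨ cong (product ∘ map f) (sym (upTo-∷ʳ N)) ⟩
  product (map f (upTo N ++ N ∷ []))       ≡⟨ cong product (map-++ f (upTo N) (N ∷ [])) ⟩
  product (map f (upTo N) ++ f N ∷ [])     ≡⟨ product-++ (map f (upTo N)) (f N ∷ []) ⟩
  product (map f (upTo N)) * (f N * 1)     ≡⟨ cong₂ _*_ (product-map-upTo f N) (*-identityʳ (f N)) ⟩
  ∏< N f * f N                             ∎

∏<-cong : ∀ {f g} N → (∀ q → q < N → f q ≡ g q) → ∏< N f ≡ ∏< N g
∏<-cong zero    _   = refl
∏<-cong (suc N) f≗g = cong₂ _*_ (∏<-cong N (λ q q<N → f≗g q (m<n⇒m<1+n q<N))) (f≗g N ≤-refl)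

∏<-extend : ∀ {f n} N → (∀ q → n ≤ q → f q ≡ 1) → n ≤ N → ∏< N f ≡ ∏< n f
∏<-extend zero    _     z≤n  = refl
∏<-extend {f} (suc N) f≗1 n≤1+N with m≤n⇒m<n∨m≡n n≤1+N
... | inj₂ refl = refl
... | inj₁ n≤N  = trans (cong₂ _*_ (∏<-extend N f≗1 (s≤s⁻¹ n≤N)) (f≗1 N (s≤s⁻¹ n≤N))) (*-identityʳ _)

except : ℕ → (ℕ → ℕ) → ℕ → ℕ
except p f q with q ≟ p
... | yes _ = 1
... | no  _ = f q

except-≢ : ∀ {p} f {q} → q ≢ p → except p f q ≡ f q
except-≢ {p} f {q} q≢p with q ≟ p
... | yes q≡p = contradiction q≡p q≢p
... | no  _   = refl

except-self : ∀ p f → except p f p ≡ 1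
except-self p f with p ≟ p
... | yes _   = refl
... | no  p≢p = contradiction refl p≢p

except-cong : ∀ {p f g} → (∀ q → q ≢ p → f q ≡ g q) → ∀ q → except p f q ≡ except p g q
except-cong {p} {f} {g} f≗g q with q ≟ p
... | yes _   = refl
... | no  q≢p = f≗g q q≢p

∏<-split : ∀ {p} f N → p < N → ∏< N f ≡ f p * ∏< N (except p f)
∏<-split {p} f (suc N) p<1+N with m≤n⇒m<n∨m≡n (s≤s⁻¹ p<1+N)
... | inj₁ p<N = begin
  ∏< N f * f N                                  ≡⟨ cong (_* f N) (∏<-split f N p<N) ⟩
  f p * ∏< N (except p f) * f N                 ≡⟨ *-assoc (f p) _ _ ⟩
  f p * (∏< N (except p f) * f N)               ≡⟨ cong (λ x → f p * (∏< N (except p f) * x)) (sym (except-≢ f (>⇒≢ p<N))) ⟩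
  f p * (∏< N (except p f) * except p f N)      ∎
... | inj₂ refl = begin
  ∏< p f * f p                                  ≡⟨ *-comm (∏< p f) (f p) ⟩
  f p * ∏< p f                                  ≡⟨ cong (f p *_) (∏<-cong p (λ q q<p → sym (except-≢ f (<⇒≢ q<p)))) ⟩
  f p * ∏< p (except p f)                       ≡⟨ cong (f p *_) (sym (*-identityʳ _)) ⟩
  f p * (∏< p (except p f) * 1)                 ≡⟨ cong (λ x → f p * (∏< p (except p f) * x)) (sym (except-self p f)) ⟩
  f p * (∏< p (except p f) * except p f p)      ∎

Sloc-≤ : ∀ {r p} v → p ≤ r → Sloc r p (suc v) ≡ 0
Sloc-≤ {r} {p} v p≤r with p ≤? r
... | yes _   = refl
... | no  p≰r = contradiction p≤r p≰r

Sloc-> : ∀ {r p} v → r < p → Sloc r p (suc v) ≡ p ^ v * (p ∸ r)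
Sloc-> {r} {p} v r<p with p ≤? r
... | yes p≤r = contradiction p≤r (<⇒≱ r<p)
... | no  _   = refl

Sloc-pos : ∀ {r p} v → r < p → 0 < Sloc r p v
Sloc-pos         zero    _   = s≤s z≤n
Sloc-pos {r} {p} (suc v) r<p = subst (0 <_) (sym (Sloc-> v r<p))
  (*-pos (m^n>0 p {{>-nonZero (≤-trans (s≤s z≤n) r<p)}} v) (m<n⇒0<n∸m r<p))

Sloc-suc-≡ : ∀ {r p v} → r < p → 1 ≤ v → Sloc r p (suc v) ≡ p * Sloc r p v
Sloc-suc-≡ {r} {p} {suc v} r<p _ = begin
  Sloc r p (suc (suc v))   ≡⟨ Sloc-> (suc v) r<p ⟩
  p * p ^ v * (p ∸ r)      ≡⟨ *-assoc p (p ^ v) (p ∸ r) ⟩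
  p * (p ^ v * (p ∸ r))    ≡⟨ cong (p *_) (sym (Sloc-> v r<p)) ⟩
  p * Sloc r p (suc v)     ∎

Sloc-suc-≤ : ∀ {r p} v → r < p → Sloc r p (suc v) ≤ p * Sloc r p v
Sloc-suc-≤ {r} {p} zero    r<p =
  subst₂ _≤_ (sym (trans (Sloc-> 0 r<p) (*-identityˡ (p ∸ r)))) (sym (*-identityʳ p)) (m∸n≤m p r)
Sloc-suc-≤ (suc v) r<p = ≤-reflexive (Sloc-suc-≡ r<p (s≤s z≤n))

Sfac-prime : ∀ r n {q} → Prime q → Sfac r n q ≡ Sloc r q (val q n)
Sfac-prime r n {q} q-prime with prime? q
... | yes _ = refl
... | no  ¬q-prime = contradiction q-prime ¬q-prime

Sfac-> : ∀ r {n q} → 1 ≤ n → n < q → Sfac r n q ≡ 1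
Sfac-> r {n} {q} 1≤n n<q with prime? q
... | no  _       = refl
... | yes q-prime = cong (Sloc r q) (val-∤ (prime⇒2≤ q-prime) (λ q∣n → <⇒≱ n<q (∣⇒≤ {{>-nonZero 1≤n}} q∣n)))

Sfac-p*-≢ : ∀ r {p m} → Prime p → 1 ≤ m → ∀ q → q ≢ p → Sfac r (p * m) q ≡ Sfac r m q
Sfac-p*-≢ r {p} {m} p-prime 1≤m q q≢p with prime? q
... | no  _       = refl
... | yes q-prime = cong (Sloc r q) (val-*-∤ q-prime (prime∤prime q-prime p-prime q≢p) 1≤m)

S-split : ∀ r {p m} → Prime p → 1 ≤ m → ∃[ R ]
  (S r (p * m) ≡ Sloc r p (suc (val p m)) * R) × (S r m ≡ Sloc r p (val p m) * R)
S-split r {p} {m} p-prime 1≤m = ∏< N (except p (Sfac r m)) , S[p*m] , S[m]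
  where
  N = suc (p * m)
  p<N : p < N
  p<N = s≤s (m≤m*n p m {{>-nonZero 1≤m}})
  S[p*m] : S r (p * m) ≡ Sloc r p (suc (val p m)) * ∏< N (except p (Sfac r m))
  S[p*m] = begin
    S r (p * m)                                          ≡⟨ product-map-upTo (Sfac r (p * m)) N ⟩
    ∏< N (Sfac r (p * m))                                ≡⟨ ∏<-split (Sfac r (p * m)) N p<N ⟩
    Sfac r (p * m) p * ∏< N (except p (Sfac r (p * m)))  ≡⟨ cong₂ _*_ p-part (∏<-cong N (λ q _ → except-cong (Sfac-p*-≢ r p-prime 1≤m) q)) ⟩
    Sloc r p (suc (val p m)) * ∏< N (except p (Sfac r m)) ∎
    where
    p-part : Sfac r (p * m) p ≡ Sloc r p (suc (val p m))
    p-part = trans (Sfac-prime r (p * m) p-prime) (cong (Sloc r p) (val-q* (prime⇒2≤ p-prime) 1≤m))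
  S[m] : S r m ≡ Sloc r p (val p m) * ∏< N (except p (Sfac r m))
  S[m] = begin
    S r m                                   ≡⟨ product-map-upTo (Sfac r m) (suc m) ⟩
    ∏< (suc m) (Sfac r m)                   ≡⟨ sym (∏<-extend N (λ q m<q → Sfac-> r 1≤m m<q) (s≤s (m≤n*m m p {{prime⇒nonZero p-prime}}))) ⟩
    ∏< N (Sfac r m)                         ≡⟨ ∏<-split (Sfac r m) N p<N ⟩
    Sfac r m p * ∏< N (except p (Sfac r m)) ≡⟨ cong (_* ∏< N (except p (Sfac r m))) (Sfac-prime r m p-prime) ⟩
    Sloc r p (val p m) * ∏< N (except p (Sfac r m)) ∎

S-p*≡0 : ∀ r {p m} → Prime p → p ≤ r → 1 ≤ m → S r (p * m) ≡ 0
S-p*≡0 r {p} {m} p-prime p≤r 1≤m with S-split r p-prime 1≤m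
... | R , S[p*m] , _ = trans S[p*m] (cong (_* R) (Sloc-≤ (val p m) p≤r))

S-p*≤ : ∀ r {p m} → Prime p → r < p → 1 ≤ m → S r (p * m) ≤ p * S r m
S-p*≤ r {p} {m} p-prime r<p 1≤m with S-split r p-prime 1≤m
... | R , S[p*m] , S[m] = subst₂ _≤_ (sym S[p*m]) (trans (*-assoc p _ R) (cong (p *_) (sym S[m])))
  (*-monoˡ-≤ R (Sloc-suc-≤ (val p m) r<p))

S-p*≡ : ∀ r {p m} → Prime p → r < p → p ∣ m → 1 ≤ m → S r (p * m) ≡ p * S r m
S-p*≡ r {p} {m} p-prime r<p p∣m 1≤m with S-split r p-prime 1≤m
... | R , S[p*m] , S[m] = begin
  S r (p * m)                      ≡⟨ S[p*m] ⟩
  Sloc r p (suc (val p m)) * R     ≡⟨ cong (_* R) (Sloc-suc-≡ r<p (val-∣ (prime⇒2≤ p-prime) p∣m 1≤m)) ⟩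
  p * Sloc r p (val p m) * R       ≡⟨ *-assoc p _ R ⟩
  p * (Sloc r p (val p m) * R)     ≡⟨ cong (p *_) (sym S[m]) ⟩
  p * S r m                        ∎

S-p*-pos : ∀ r {p m} → Prime p → r < p → 1 ≤ m → 0 < S r m → 0 < S r (p * m)
S-p*-pos r {p} {m} p-prime r<p 1≤m S[m]>0 with S-split r p-prime 1≤m
... | R , S[p*m] , S[m] = subst (0 <_) (sym S[p*m])
  (*-pos (Sloc-pos (suc (val p m)) r<p) (*-pos⁻¹ʳ (Sloc r p (val p m)) (subst (0 <_) S[m] S[m]>0)))

F-p*⇒F : ∀ {r p m} → Prime p → p ∣ m → F r (p * m) → F r m
F-p*⇒F {r} {p} {m} p-prime p∣m ((1≤p*m , S[p*m]>0) , minimal) = (1≤m , S[m]>0) , below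
  where
  1≤m : 1 ≤ m
  1≤m = *-pos⁻¹ʳ p 1≤p*m
  0<p : 0 < p
  0<p = ≤-trans (s≤s z≤n) (prime⇒2≤ p-prime)
  r<p : r < p
  r<p = ≰⇒> (λ p≤r → >⇒≢ S[p*m]>0 (S-p*≡0 r p-prime p≤r 1≤m))
  S[p*m]≡ : S r (p * m) ≡ p * S r m
  S[p*m]≡ = S-p*≡ r p-prime r<p p∣m 1≤m
  S[m]>0 : 0 < S r m
  S[m]>0 = *-pos⁻¹ʳ p (subst (0 <_) S[p*m]≡ S[p*m]>0)
  below : ∀ k → B r k → k > m → S r m < S r k
  below k (1≤k , S[k]>0) m<k = *-cancelˡ-< p (S r m) (S r k) (<-≤-trans
    (subst (_< S r (p * k)) S[p*m]≡
      (minimal (p * k) (*-pos 0<p 1≤k , S-p*-pos r p-prime r<p 1≤k S[k]>0) (*-monoʳ-< p {{>-nonZero 0<p}} m<k)))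
    (S-p*≤ r p-prime r<p 1≤k))

-- Since α > 1, p already divides p^(α-1) γ.
lemma3p2 : (p r α γ : ℕ) → Prime p → 1 ≤ r → 1 < α → 1 ≤ γ → ¬ (p ∣ γ) →
    F r (p ^ α * γ) → F r (p ^ (α ∸ 1) * γ)
lemma3p2 p r (suc (suc a)) γ p-prime _ (s≤s (s≤s z≤n)) _ _ F[p^α*γ] =
  F-p*⇒F p-prime (∣m⇒∣m*n γ (m∣m*n (p ^ a))) (subst (F r) (*-assoc p (p ^ suc a) γ) F[p^α*γ])
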